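{- Let $p\ge 2$ and $k\ge1$ be integers and $a,b\in\{0,\dots,p-1\}$ with $b<\frac{p}{2}$. Let $S=(s_0,\dots,s_{k-1})$ with $s_i=(a+ib)\bmod p$. For integers $r>q\ge0$, if $x\in f_r(S)$ and $y\in f_q(S)$, then $x>y$.
   Context: An index $i\ge1$ of $S$ is a flip location if $s_i<s_{i-1}$; the index $0$ is a flip location if $(a-b)\bmod p>a$. For an integer $r\ge0$, $f_r(S)$ is the set of values $s_i$ at indices $i$ such that $i-r$ is a flip location and none of the indices $i-r+1,\dots,i$ is a flip location (i.e. $s_i$ occurs exactly $r$ places after the closest flip location at or before it); in particular $f_0(S)$ is the set of values at flip locations. Here $x\bmod p$ denotes the representative in $\{0,\dots,p-1\}$. -}

module Defs where

open import Data.Nat using (ℕ; zero; suc; _+_; _*_; _∸_; _≤_; _<_; NonZero)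
open import Data.Nat.DivMod using (_%_)
open import Data.Integer as ℤ using (ℤ; +_)
open import Data.Integer.DivMod using (_%ℕ_)
open import Data.Product using (Σ; _×_)
open import Relation.Binary.PropositionalEquality using (_≡_)
open import Relation.Nullary using (¬_)

module _ (p : ℕ) .{{_ : NonZero p}} (a b : ℕ) where

  seqS : ℕ → ℕ
  seqS i = (a + i * b) % p

  -- flip locations of S (index 0 uses the paper's special rule (a-b) mod p > a,
  -- with the mod computed on integers)
  Flip : ℕ → Set
  Flip zero    = a < ((+ a) ℤ.- (+ b)) %ℕ p
  Flip (suc j) = seqS (suc j) < seqS j

  InF : (k r x : ℕ) → Set
  InF k r x = Σ ℕ λ i →
      i < k × r ≤ i × Flip (i ∸ r)
    × (∀ j → i ∸ r < j → j ≤ i → ¬ Flip j)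
    × seqS i ≡ x

-- Values of f_r(S) lie in the band [r·b, r·b + b), so they increase with r.
--
-- Write s_i = (a + i b) mod p with a, b < p.  One step adds b modulo p, so
-- either s_{m+1} = s_m + b ("no wrap"), or the sum passes p and then
-- s_{m+1} = s_m + b - p is below both b and s_m ("wrap").  Consequently
--   * the flip locations after 0 are exactly the wraps, and every flip value
--     is < b (for index 0 this is the paper's special rule (a-b) mod p > a,
--     which forces a < b);
--   * between consecutive flips S grows by exactly b per step.
-- Hence an element of f_r(S) equals c + r·b for some flip value c < b.
-- For q < r this gives y = d + q·b < (q+1)·b ≤ r·b ≤ x.
module Submission where

open import Defs
open import Data.Nat using (ℕ; zero; suc; s≤s; _+_; _*_; _∸_; _≤_; _<_; _>_; NonZero)
open import Data.Nat.Properties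
open import Data.Nat.DivMod
import Data.Integer as ℤ
import Data.Integer.Properties as ℤP
open import Data.Product using (Σ; _×_; _,_; proj₁; proj₂)
open import Relation.Binary.PropositionalEquality
open import Relation.Nullary using (¬_; yes; no)
open import Data.Empty using (⊥-elim)

wrap-below : ∀ {p u b} → u < p → b < p → p ≤ u + b → u + b ∸ p < b × u + b ∸ p < u
wrap-below {p} {u} {b} u<p b<p p≤u+b =
    subst (u + b ∸ p <_) (m+n∸m≡n p b) (∸-monoˡ-< (+-monoˡ-< b u<p) p≤u+b)
  , subst (u + b ∸ p <_) (m+n∸n≡m u p) (∸-monoˡ-< (+-monoʳ-< u b<p) p≤u+b)

%-sub-modulus : ∀ n p .{{_ : NonZero p}} → p ≤ n → n % p ≡ (n ∸ p) % p
%-sub-modulus n p p≤n = begin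
    n % p              ≡⟨ cong (_% p) (sym (m∸n+n≡m p≤n)) ⟩
    (n ∸ p + p) % p    ≡⟨ [m+n]%n≡m%n (n ∸ p) p ⟩
    (n ∸ p) % p        ∎
  where open ≡-Reasoning

module Progression (p : ℕ) .{{_ : NonZero p}} (a b : ℕ) (a<p : a < p) (b<p : b < p) where

  S : ℕ → ℕ
  S = seqS p a b

  F : ℕ → Set
  F = Flip p a b

  S-suc : ∀ m → S (suc m) ≡ (S m + b) % p
  S-suc m = begin
      (a + (b + m * b)) % p   ≡⟨ cong (λ z → (a + z) % p) (+-comm b (m * b)) ⟩
      (a + (m * b + b)) % p   ≡⟨ cong (_% p) (sym (+-assoc a (m * b) b)) ⟩
      (S' + b) % p            ≡⟨ %-distribˡ-+ S' b p ⟩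
      (S m + b % p) % p       ≡⟨ cong (λ z → (S m + z) % p) (m<n⇒m%n≡m b<p) ⟩
      (S m + b) % p           ∎
    where
      open ≡-Reasoning
      S' = a + m * b

  data Step (m : ℕ) : Set where
    no-wrap : S (suc m) ≡ S m + b → Step m
    wrap    : S (suc m) < b → S (suc m) < S m → Step m

  step : ∀ m → Step m
  step m with S m + b <? p
  ... | yes sum<p = no-wrap (trans (S-suc m) (m<n⇒m%n≡m sum<p))
  ... | no sum≮p  = wrap (≤-<-trans le below-b) (≤-<-trans le below-Sm)
    where
      p≤sum = ≮⇒≥ sum≮p
      le : S (suc m) ≤ S m + b ∸ p
      le = subst (_≤ S m + b ∸ p)
                 (sym (trans (S-suc m) (%-sub-modulus (S m + b) p p≤sum)))
                 (m%n≤m (S m + b ∸ p) p)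
      bounds = wrap-below (m%n<n (a + m * b) p) b<p p≤sum
      below-b  = proj₁ bounds
      below-Sm = proj₂ bounds

  -- Index 0 is a flip location only when a < b, and then s_0 = a.
  flip₀-below : F 0 → S 0 < b
  flip₀-below fl with b ≤? a
  ... | no b≰a = subst (_< b) (sym S0≡a) (≰⇒> b≰a)
    where S0≡a = trans (cong (_% p) (+-identityʳ a)) (m<n⇒m%n≡m a<p)
  ... | yes b≤a = ⊥-elim (<⇒≱ fl (begin
      (ℤ.+ a ℤ.- ℤ.+ b) ℤ.%ℕ p  ≡⟨ cong (ℤ._%ℕ p) (trans (ℤP.m-n≡m⊖n a b) (ℤP.⊖-≥ b≤a)) ⟩
      (a ∸ b) % p               ≤⟨ m%n≤m (a ∸ b) p ⟩
      a ∸ b                     ≤⟨ m∸n≤m a b ⟩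
      a                         ∎))
    where open ≤-Reasoning

  flip-below : ∀ j → F j → S j < b
  flip-below zero    fl = flip₀-below fl
  flip-below (suc m) fl with step m
  ... | no-wrap e  = ⊥-elim (<⇒≱ fl (subst (S m ≤_) (sym e) (m≤m+n (S m) b)))
  ... | wrap lt _ = lt

  no-flip-run : ∀ j t → (∀ l → j < l → l ≤ j + t → ¬ F l) → S (j + t) ≡ S j + t * b
  no-flip-run j zero    _  = trans (cong S (+-identityʳ j)) (sym (+-identityʳ (S j)))
  no-flip-run j (suc t) nf with step (j + t)
  ... | wrap _ dropped = ⊥-elim (nf (suc (j + t)) (s≤s (m≤m+n j t)) (≤-reflexive (sym (+-suc j t))) dropped)
  ... | no-wrap e = begin
      S (j + suc t)       ≡⟨ cong S (+-suc j t) ⟩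
      S (suc (j + t))     ≡⟨ e ⟩
      S (j + t) + b       ≡⟨ cong (_+ b) (no-flip-run j t nf-shorter) ⟩
      S j + t * b + b     ≡⟨ +-assoc (S j) (t * b) b ⟩
      S j + (t * b + b)   ≡⟨ cong (S j +_) (+-comm (t * b) b) ⟩
      S j + suc t * b     ∎
    where
      open ≡-Reasoning
      nf-shorter : ∀ l → j < l → l ≤ j + t → ¬ F l
      nf-shorter l j<l l≤j+t = nf l j<l (≤-trans l≤j+t (≤-trans (n≤1+n (j + t)) (≤-reflexive (sym (+-suc j t)))))

  InF-band : ∀ k r x → InF p a b k r x → Σ ℕ λ c → c < b × x ≡ c + r * b
  InF-band k r x (i , _ , r≤i , fl , nf , Si≡x) =
      S (i ∸ r)
    , flip-below (i ∸ r) fl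
    , trans (sym Si≡x) (trans (cong S (sym i∸r+r≡i)) (no-flip-run (i ∸ r) r nf'))
    where
      i∸r+r≡i = m∸n+n≡m r≤i
      nf' : ∀ l → i ∸ r < l → l ≤ i ∸ r + r → ¬ F l
      nf' l lo hi = nf l lo (subst (l ≤_) i∸r+r≡i hi)

band-monotone : ∀ {b c d q r} → d < b → q < r → d + q * b < c + r * b
band-monotone {b} {c} {d} {q} {r} d<b q<r = begin-strict
    d + q * b    <⟨ +-monoˡ-< (q * b) d<b ⟩
    suc q * b    ≤⟨ *-monoˡ-≤ b q<r ⟩
    r * b        ≤⟨ m≤n+m (r * b) c ⟩
    c + r * b    ∎
  where open ≤-Reasoning

lemma4 : (p k a b : ℕ) .{{_ : NonZero p}} → 2 ≤ p → 1 ≤ k → a < p → b < p → 2 * b < p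
       → (r q x y : ℕ) → q < r
       → InF p a b k r x → InF p a b k q y → x > y
lemma4 p k a b _ _ a<p b<p _ r q x y q<r x∈fr y∈fq
  with Progression.InF-band p a b a<p b<p k r x x∈fr
     | Progression.InF-band p a b a<p b<p k q y y∈fq
... | c , _ , x≡ | d , d<b , y≡ =
  subst₂ _<_ (sym y≡) (sym x≡) (band-monotone {c = c} d<b q<r)
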